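{- Let $\mathcal S=(\Psi,\Sigma,(\mathcal N,\rho),\Lambda_{\mathcal S})$ and $\mathcal P=(\Xi,\Omega,(\mathcal M,d),\Lambda_{\mathcal P})$ be computational problems with $\mathcal S\le_{G,\mathrm{fq}}\mathcal P$, witnessed by $E$, $D$, $(m_f,\gamma_{f,1},\dots,\gamma_{f,m_f},\vartheta_f)_{f\in\Lambda_{\mathcal P}}$. Let $(\Gamma_{\mathcal P},\Lambda_{\Gamma_{\mathcal P}})$ be a general algorithm on $\mathcal P$. Define $\Gamma_{\mathcal S}(A):=D(\Gamma_{\mathcal P}(E(A)))$ and $\Lambda_{\Gamma_{\mathcal S}}(A):=\bigcup_{f\in\Lambda_{\Gamma_{\mathcal P}}(E(A))}\{\gamma_{f,1},\dots,\gamma_{f,m_f}\}$ for $A\in\Sigma$. Then $(\Gamma_{\mathcal S},\Lambda_{\Gamma_{\mathcal S}})$ is a general algorithm on $\mathcal S$.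
   Context: A computational problem is $(\Xi,\Omega,(\mathcal M,d),\Lambda)$ with $\Xi:\Omega\to\mathcal M$ into a metric space and $\Lambda$ a set of functions $\Omega\to\mathbb C$ such that $\Xi(A)\ne\Xi(B)$ implies $f(A)\ne f(B)$ for some $f\in\Lambda$. A general algorithm on it is $(\Gamma,\Lambda_\Gamma)$ with $\Gamma:\Omega\to\mathcal M$, $\Lambda_\Gamma(A)$ a finite nonempty subset of $\Lambda$, such that if $f(B)=f(A)$ for all $f\in\Lambda_\Gamma(A)$ then $\Gamma(B)=\Gamma(A)$ and $\Lambda_\Gamma(B)=\Lambda_\Gamma(A)$. Finite-query evaluation reduction: $\mathcal S\le_{G,\mathrm{fq}}\mathcal P$ means there exist a map $E:\Sigma\to\Omega$, a continuous map $D:(\mathcal M,d)\to(\mathcal N,\rho)$, and for every $f\in\Lambda_{\mathcal P}$ a number $m_f\in\mathbb N=\{1,2,\dots\}$, evaluations $\gamma_{f,1},\dots,\gamma_{f,m_f}\in\Lambda_{\mathcal S}$ and a map $\vartheta_f:\operatorname{im}(\gamma_{f,1},\dots,\gamma_{f,m_f})\to\mathbb C$ such that for all $A\in\Sigma$: $\Psi(A)=D(\Xi(E(A)))$ and $f(E(A))=\vartheta_f(\gamma_{f,1}(A),\dots,\gamma_{f,m_f}(A))$. -}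

module Defs where

open import Data.Nat using (ℕ; _≤_)
open import Data.Fin using (Fin)
open import Data.Vec using (Vec; tabulate; toList)
open import Data.List using (List; []; concatMap)
open import Data.List.Relation.Unary.All using (All)
open import Data.List.Relation.Binary.BagAndSetEquality using (_∼[_]_; set)
open import Data.Product using (∃; _×_; _,_)
open import Data.Irrelevant using ([_])
open import Data.Refinement using (Refinement) renaming (_,_ to _▹_)
open import Relation.Binary.PropositionalEquality using (_≡_; _≢_; refl)

-- A computational problem (Ξ, Ω, (M,d), Λ) whose evaluations take values in C
-- (C plays the role of ℂ).  Λ is represented by an index type Ev together
-- with the evaluation map eval : Ev → Ω → C.
record CompProblem (C : Set) : Set₁ where
  field
    Inp       : Set
    Out       : Set                 -- underlying set of the metric space M
    sol       : Inp → Out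
    Ev        : Set
    eval      : Ev → Inp → C
    separates : ∀ A B → sol A ≢ sol B → ∃ λ f → eval f A ≢ eval f B

open CompProblem public

-- (Γ, Λ_Γ) is a general algorithm on P.  Λ_Γ(A) is a finite subset of Λ,
-- given by a list; equality of such subsets is set equality of lists.
record IsGeneralAlgorithm {C : Set} (P : CompProblem C)
         (Γ : Inp P → Out P) (ΛΓ : Inp P → List (Ev P)) : Set where
  field
    nonempty   : ∀ A → ΛΓ A ≢ []
    consistent : ∀ A B → All (λ f → eval P f B ≡ eval P f A) (ΛΓ A) →
                 (Γ B ≡ Γ A) × (ΛΓ B ∼[ set ] ΛΓ A)

values : {C : Set} (S : CompProblem C) {m : ℕ} → (Fin m → Ev S) → Inp S → Vec C m
values S γ A = tabulate (λ i → eval S (γ i) A)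

Image : {C : Set} (S : CompProblem C) {m : ℕ} → (Fin m → Ev S) → Set
Image {C} S {m} γ = Refinement (Vec C m) (λ v → ∃ λ A → v ≡ values S γ A)

record FQReduction {C : Set} (S P : CompProblem C) : Set₁ where
  field
    E       : Inp S → Inp P
    D       : Out P → Out S
    sol-eq  : ∀ A → sol S A ≡ D (sol P (E A))
    m       : Ev P → ℕ
    m-pos   : ∀ f → 1 ≤ m f
    γ       : (f : Ev P) → Fin (m f) → Ev S
    ϑ       : (f : Ev P) → Image S (γ f) → C
    eval-eq : ∀ f A → eval P f (E A) ≡
                ϑ f (values S (γ f) A ▹ [ (A , refl) ])

inducedΓ : {C : Set} {S P : CompProblem C} → FQReduction S P →
           (Inp P → Out P) → Inp S → Out S
inducedΓ R Γ A = FQReduction.D R (Γ (FQReduction.E R A))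

inducedΛ : {C : Set} {S P : CompProblem C} → FQReduction S P →
           (Inp P → List (Ev P)) → Inp S → List (Ev S)
inducedΛ R ΛΓ A =
  concatMap (λ f → toList (tabulate (FQReduction.γ R f))) (ΛΓ (FQReduction.E R A))

{-# OPTIONS --safe #-}
module Submission where

-- Each P-evaluation f is recovered by ϑ_f from the S-evaluations γ_{f,i}, so two S-inputs
-- agreeing on Λ_{Γ_S}(A) have E-images agreeing on Λ_{Γ_P}(E A); the consistency of Γ_P
-- then transfers to Γ_S through D, and to Λ_{Γ_S} because concatMap respects set equality.

open import Defs
open import Data.List using (List; []; _∷_; concatMap)
open import Data.List.Properties using (++-conicalˡ)
open import Data.List.Relation.Unary.All as All using (All)
import Data.List.Relation.Unary.All.Properties as AllP
open import Data.List.Relation.Binary.BagAndSetEquality using (_∼[_]_; set; >>=-cong)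
open import Data.Nat using (ℕ; _≤_; s≤s)
open import Data.Fin using (Fin)
open import Data.Vec using (tabulate; toList)
open import Data.Vec.Properties using (tabulate-cong)
import Data.Vec.Relation.Unary.All.Properties as VecAll
open import Data.Product using (_,_)
open import Data.Refinement using (value-injective) renaming (_,_ to _▹_)
open import Function using (_∘′_)
open import Function.Related.Propositional using (K-refl)
open import Relation.Binary.PropositionalEquality using (_≡_; _≢_; refl; cong; sym; module ≡-Reasoning)

AgreeOn : {C : Set} (P : CompProblem C) → List (Ev P) → Inp P → Inp P → Set
AgreeOn P fs A B = All (λ f → eval P f B ≡ eval P f A) fs

toList-tabulate-nonempty : {X : Set} {n : ℕ} → 1 ≤ n → (g : Fin n → X) → toList (tabulate g) ≢ []
toList-tabulate-nonempty (s≤s _) _ ()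

concatMap-nonempty : {X Y : Set} {f : X → List Y} {xs : List X} →
                     (∀ x → f x ≢ []) → xs ≢ [] → concatMap f xs ≢ []
concatMap-nonempty {xs = []}             _          []≢[] = λ _ → []≢[] refl
concatMap-nonempty {f = f} {xs = x ∷ xs} f-nonempty _     =
  f-nonempty x ∘′ ++-conicalˡ (f x) (concatMap f xs)

concatMap-cong-set : {X Y : Set} (f : X → List Y) {xs ys : List X} →
                     xs ∼[ set ] ys → concatMap f xs ∼[ set ] concatMap f ys
concatMap-cong-set f xs∼ys = >>=-cong xs∼ys (λ _ → K-refl)

values-cong : {C : Set} (S : CompProblem C) {m : ℕ} (γ : Fin m → Ev S) {A B : Inp S} →
              AgreeOn S (toList (tabulate γ)) A B → values S γ B ≡ values S γ A
values-cong S γ agree = tabulate-cong (VecAll.tabulate⁻ (VecAll.toList⁻ agree))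

module _ {C : Set} {S P : CompProblem C} (R : FQReduction S P) where
  open FQReduction R

  queries : Ev P → List (Ev S)
  queries f = toList (tabulate (γ f))

  eval-E-cong : ∀ f {A B} → AgreeOn S (queries f) A B → eval P f (E B) ≡ eval P f (E A)
  eval-E-cong f {A} {B} agree = begin
    eval P f (E B)                  ≡⟨ eval-eq f B ⟩
    ϑ f (values S (γ f) B ▹ _)      ≡⟨ cong (ϑ f) (value-injective (values-cong S (γ f) agree)) ⟩
    ϑ f (values S (γ f) A ▹ _)      ≡⟨ sym (eval-eq f A) ⟩
    eval P f (E A)                  ∎
    where open ≡-Reasoning

  AgreeOn-E : ∀ fs {A B} → AgreeOn S (concatMap queries fs) A B → AgreeOn P fs (E A) (E B)
  AgreeOn-E fs agree = All.map (λ {f} → eval-E-cong f) (AllP.map⁻ (AllP.concat⁻ agree))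

lemma4p10 : {C : Set} (S P : CompProblem C) (R : FQReduction S P)
            (Γ : Inp P → Out P) (ΛΓ : Inp P → List (Ev P)) →
            IsGeneralAlgorithm P Γ ΛΓ →
            IsGeneralAlgorithm S (inducedΓ R Γ) (inducedΛ R ΛΓ)
lemma4p10 S P R Γ ΛΓ alg = record
  { nonempty   = λ A → concatMap-nonempty
                         (λ f → toList-tabulate-nonempty (m-pos f) (γ f)) (nonempty (E A))
  ; consistent = λ A B agree →
      let Γ-eq , ΛΓ-eq = consistent (E A) (E B) (AgreeOn-E R (ΛΓ (E A)) agree)
      in cong D Γ-eq , concatMap-cong-set (queries R) ΛΓ-eq
  }
  where
  open FQReduction R
  open IsGeneralAlgorithm alg
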